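{- Let $\ell$ be a prime and $n,j$ positive integers with $b:=\mathrm{ord}_\ell(n) < j$. Then $$f(-\ell^j;n)\equiv 0 \pmod{\ell^{j-b}}.$$
   Context: The D'Arcais polynomials $f(r;n)$ are defined by $\prod_{m=1}^\infty (1-q^m)^r = \sum_{n=0}^\infty f(r;n)q^n$; for integer $r$ these values are integers. -}

module Defs where

open import Data.Nat as ℕ using (ℕ; zero; suc)
open import Data.Integer as ℤ using (ℤ; +_; -[1+_]; _+_; _*_; -_; 0ℤ; 1ℤ)
open import Data.Empty using (⊥)
open import Data.Nat.Divisibility using (_∣?_; _∣_)
open import Relation.Nullary using (yes; no)

-- Formal power series over ℤ, represented by their coefficient sequences.
Series : Set
Series = ℕ → ℤ

sumTo : ℕ → (ℕ → ℤ) → ℤ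
sumTo zero    g = g 0
sumTo (suc n) g = sumTo n g + g (suc n)

one : Series
one zero    = 1ℤ
one (suc _) = 0ℤ

_⊛_ : Series → Series → Series
(a ⊛ b) n = sumTo n (λ i → a i * b (n ℕ.∸ i))

-- (1 - q^m) as a power series
oneMinusQ^ : ℕ → Series
oneMinusQ^ m n with n ℕ.≟ 0 | n ℕ.≟ m
... | yes _ | yes _ = 0ℤ        -- only when m = 0
... | yes _ | no _  = 1ℤ
... | no _  | yes _ = - 1ℤ
... | no _  | no _  = 0ℤ

-- 1/(1 - q^m) = Σ_k q^{mk}, for m ≥ 1: coefficient n is 1 iff m ∣ n
invOneMinusQ^ : ℕ → Series
invOneMinusQ^ m n with m ∣? n
... | yes _ = 1ℤ
... | no _  = 0ℤ

pow : Series → ℕ → Series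
pow a zero    = one
pow a (suc k) = a ⊛ pow a k

-- (1 - q^m)^r for integer r (m ≥ 1)
factor : ℤ → ℕ → Series
factor (+ k)     m = pow (oneMinusQ^ m) k
factor -[1+ k ]  m = pow (invOneMinusQ^ m) (suc k)

partialProd : ℤ → ℕ → Series
partialProd r zero    = one
partialProd r (suc N) = factor r (suc N) ⊛ partialProd r N

-- D'Arcais coefficient f(r;n): coefficient of q^n in ∏_{m≥1} (1-q^m)^r.
-- Factors with m > n do not affect the coefficient of q^n, so the
-- finite product up to m = n gives exactly the coefficient.
darcais : ℤ → ℕ → ℤ
darcais r n = partialProd r n n

record Ord (ℓ n b : ℕ) : Set where
  field
    divides    : (ℓ ℕ.^ b) ∣ n
    notDivides : (ℓ ℕ.^ suc b) ∣ n → ⊥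

{-# OPTIONS --safe #-}
-- With θ = q d/dq, the Leibniz rule gives θ(a^M) = M · a^(M-1) · θa, so θP has all coefficients
-- divisible by M when P is an M-th power and, again by Leibniz, when P is a product of such.
-- Since ∏ (1-q^m)^(-M) is one, n · f(-M;n) ≡ 0 (mod M). For M = ℓ^j the factor n absorbs only ℓ^b of ℓ^j, and the
-- remaining ℓ^(j-b) must divide f(-ℓ^j;n).
module Submission where

open import Defs
open import Data.Nat using (ℕ; suc; _^_; _∸_; _<_; _≤_)
open import Data.Nat.Primality using (Prime)
open import Data.Integer using (ℤ; +_; -_)
open import Data.Integer.Divisibility using (_∣_)

open import Data.Nat as ℕ using (zero; z≤n; NonZero)
import Data.Nat.Properties as ℕ
import Data.Nat.Divisibility as ℕ
open import Data.Nat.Primality using (euclidsLemma; prime⇒nonZero)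
import Data.Nat.Tactic.RingSolver as ℕ-Solver
open import Data.Integer using (_+_; _*_; 0ℤ; 1ℤ; -[1+_]; ∣_∣)
import Data.Integer.Properties as ℤ
open import Data.Integer.Tactic.RingSolver using (solve-∀)
open import Data.Sum using (inj₁; inj₂)
open import Relation.Nullary using (¬_; contradiction)
open import Relation.Binary.PropositionalEquality
open ≡-Reasoning

sumTo-cong : ∀ n {f g : ℕ → ℤ} → (∀ i → i ≤ n → f i ≡ g i) → sumTo n f ≡ sumTo n g
sumTo-cong zero    f≗g = f≗g 0 z≤n
sumTo-cong (suc n) f≗g =
  cong₂ _+_ (sumTo-cong n (λ i i≤n → f≗g i (ℕ.m≤n⇒m≤1+n i≤n))) (f≗g (suc n) ℕ.≤-refl)

sumTo-distrib-+ : ∀ n (f g : ℕ → ℤ) → sumTo n (λ i → f i + g i) ≡ sumTo n f + sumTo n g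
sumTo-distrib-+ zero    f g = refl
sumTo-distrib-+ (suc n) f g =
  trans (cong (_+ (f (suc n) + g (suc n))) (sumTo-distrib-+ n f g))
        (interchange (sumTo n f) (sumTo n g) (f (suc n)) (g (suc n)))
  where
  interchange : ∀ a b c d → (a + b) + (c + d) ≡ (a + c) + (b + d)
  interchange = solve-∀

sumTo-*ˡ : ∀ n c (f : ℕ → ℤ) → sumTo n (λ i → c * f i) ≡ c * sumTo n f
sumTo-*ˡ zero    c f = refl
sumTo-*ˡ (suc n) c f = trans (cong (_+ (c * f (suc n))) (sumTo-*ˡ n c f))
                             (sym (ℤ.*-distribˡ-+ c (sumTo n f) (f (suc n))))

sumTo-suc : ∀ n (f : ℕ → ℤ) → sumTo (suc n) f ≡ f 0 + sumTo n (λ i → f (suc i))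
sumTo-suc zero    f = refl
sumTo-suc (suc n) f = trans (cong (_+ f (suc (suc n))) (sumTo-suc n f)) (ℤ.+-assoc (f 0) _ _)

sumTo-reverse : ∀ n (f : ℕ → ℤ) → sumTo n f ≡ sumTo n (λ i → f (n ∸ i))
sumTo-reverse zero    f = refl
sumTo-reverse (suc n) f = sym (begin
  sumTo n (λ i → f (suc n ∸ i)) + f (n ∸ n)
    ≡⟨ cong₂ _+_ (sumTo-cong n (λ i i≤n → cong f (ℕ.+-∸-assoc 1 i≤n))) (cong f (ℕ.n∸n≡0 n)) ⟩
  sumTo n (λ i → f (suc (n ∸ i))) + f 0
    ≡⟨ cong (_+ f 0) (sym (sumTo-reverse n (λ i → f (suc i)))) ⟩
  sumTo n (λ i → f (suc i)) + f 0
    ≡⟨ ℤ.+-comm _ (f 0) ⟩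
  f 0 + sumTo n (λ i → f (suc i))
    ≡⟨ sym (sumTo-suc n f) ⟩
  sumTo (suc n) f ∎)

sumTo-triangle-swap : ∀ n (F : ℕ → ℕ → ℤ) →
  sumTo n (λ i → sumTo (n ∸ i) (F i)) ≡ sumTo n (λ s → sumTo s (λ i → F i (s ∸ i)))
sumTo-triangle-swap zero    F = refl
sumTo-triangle-swap (suc n) F = begin
  sumTo n (λ i → sumTo (suc n ∸ i) (F i)) + sumTo (n ∸ n) (F (suc n))
    ≡⟨ cong₂ _+_ (sumTo-cong n (λ i i≤n → cong (λ k → sumTo k (F i)) (ℕ.+-∸-assoc 1 i≤n)))
                 (cong (λ k → sumTo k (F (suc n))) (ℕ.n∸n≡0 n)) ⟩
  sumTo n (λ i → sumTo (n ∸ i) (F i) + F i (suc (n ∸ i))) + F (suc n) 0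
    ≡⟨ cong (_+ F (suc n) 0) (sumTo-distrib-+ n _ _) ⟩
  (inner + diagonal) + F (suc n) 0
    ≡⟨ ℤ.+-assoc inner diagonal (F (suc n) 0) ⟩
  inner + (diagonal + F (suc n) 0)
    ≡⟨ cong₂ _+_ (sumTo-triangle-swap n F)
         (cong₂ _+_ (sumTo-cong n (λ i i≤n → cong (F i) (sym (ℕ.+-∸-assoc 1 i≤n))))
                    (cong (F (suc n)) (sym (ℕ.n∸n≡0 n)))) ⟩
  sumTo n (λ s → sumTo s (λ i → F i (s ∸ i))) + sumTo (suc n) (λ i → F i (suc n ∸ i)) ∎
  where
  inner diagonal : ℤ
  inner    = sumTo n (λ i → sumTo (n ∸ i) (F i))
  diagonal = sumTo n (λ i → F i (suc (n ∸ i)))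

infixr 7 _·_

_·_ : ℤ → Series → Series
(c · a) n = c * a n

⊛-congˡ : ∀ (a a′ b : Series) → (∀ i → a i ≡ a′ i) → ∀ n → (a ⊛ b) n ≡ (a′ ⊛ b) n
⊛-congˡ a a′ b a≗a′ n = sumTo-cong n (λ i _ → cong (_* b (n ∸ i)) (a≗a′ i))

⊛-congʳ : ∀ (a b b′ : Series) → (∀ i → b i ≡ b′ i) → ∀ n → (a ⊛ b) n ≡ (a ⊛ b′) n
⊛-congʳ a b b′ b≗b′ n = sumTo-cong n (λ i _ → cong (a i *_) (b≗b′ (n ∸ i)))

⊛-comm : ∀ (a b : Series) n → (a ⊛ b) n ≡ (b ⊛ a) n
⊛-comm a b n = trans (sumTo-reverse n (λ i → a i * b (n ∸ i)))
  (sumTo-cong n (λ i i≤n → trans (cong (λ k → a (n ∸ i) * b k) (ℕ.m∸[m∸n]≡n i≤n))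
                                 (ℤ.*-comm (a (n ∸ i)) (b i))))

⊛-·ˡ : ∀ c (a b : Series) n → ((c · a) ⊛ b) n ≡ c * (a ⊛ b) n
⊛-·ˡ c a b n = trans (sumTo-cong n (λ i _ → ℤ.*-assoc c (a i) (b (n ∸ i))))
                     (sumTo-*ˡ n c (λ i → a i * b (n ∸ i)))

⊛-·ʳ : ∀ c (a b : Series) n → (a ⊛ (c · b)) n ≡ c * (a ⊛ b) n
⊛-·ʳ c a b n = trans (sumTo-cong n (λ i _ → left-commute (a i) c (b (n ∸ i))))
                     (sumTo-*ˡ n c (λ i → a i * b (n ∸ i)))
  where
  left-commute : ∀ x y z → x * (y * z) ≡ y * (x * z)
  left-commute = solve-∀

⊛-zeroʳ : ∀ (a b : Series) → (∀ i → b i ≡ 0ℤ) → ∀ n → (a ⊛ b) n ≡ 0ℤ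
⊛-zeroʳ a b b≗0 n = begin
  (a ⊛ b) n        ≡⟨ ⊛-congʳ a b (0ℤ · b) (λ i → trans (b≗0 i) (sym (ℤ.*-zeroˡ (b i)))) n ⟩
  (a ⊛ (0ℤ · b)) n ≡⟨ ⊛-·ʳ 0ℤ a b n ⟩
  0ℤ               ∎

⊛-assoc : ∀ (a b c : Series) n → ((a ⊛ b) ⊛ c) n ≡ (a ⊛ (b ⊛ c)) n
⊛-assoc a b c n = begin
  sumTo n (λ s → sumTo s (λ i → a i * b (s ∸ i)) * c (n ∸ s))
    ≡⟨ sumTo-cong n (λ s _ → trans (ℤ.*-comm _ (c (n ∸ s)))
         (trans (sym (sumTo-*ˡ s (c (n ∸ s)) (λ i → a i * b (s ∸ i))))
                (sumTo-cong s (λ i _ → ℤ.*-comm (c (n ∸ s)) (a i * b (s ∸ i)))))) ⟩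
  sumTo n (λ s → sumTo s (λ i → a i * b (s ∸ i) * c (n ∸ s)))
    ≡⟨ sumTo-cong n (λ s _ → sumTo-cong s (λ i i≤s →
         trans (ℤ.*-assoc (a i) (b (s ∸ i)) (c (n ∸ s)))
               (cong (λ k → a i * (b (s ∸ i) * c k)) (∸-split i s i≤s)))) ⟩
  sumTo n (λ s → sumTo s (λ i → F i (s ∸ i)))
    ≡⟨ sym (sumTo-triangle-swap n F) ⟩
  sumTo n (λ i → sumTo (n ∸ i) (F i))
    ≡⟨ sumTo-cong n (λ i _ → sumTo-*ˡ (n ∸ i) (a i) (λ k → b k * c (n ∸ i ∸ k))) ⟩
  sumTo n (λ i → a i * sumTo (n ∸ i) (λ k → b k * c (n ∸ i ∸ k))) ∎
  where
  F : ℕ → ℕ → ℤ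
  F i k = a i * (b k * c (n ∸ i ∸ k))
  ∸-split : ∀ i s → i ≤ s → n ∸ s ≡ n ∸ i ∸ (s ∸ i)
  ∸-split i s i≤s = trans (cong (n ∸_) (sym (ℕ.m+[n∸m]≡n i≤s))) (sym (ℕ.∸-+-assoc n i (s ∸ i)))

θ : Series → Series
θ a n = + n * a n

θ-one : ∀ n → θ one n ≡ 0ℤ
θ-one zero    = refl
θ-one (suc n) = ℤ.*-zeroʳ (+ suc n)

θ-⊛ : ∀ (a b : Series) n → θ (a ⊛ b) n ≡ (θ a ⊛ b) n + (a ⊛ θ b) n
θ-⊛ a b n = begin
  + n * sumTo n (λ i → a i * b (n ∸ i))
    ≡⟨ sym (sumTo-*ˡ n (+ n) _) ⟩
  sumTo n (λ i → + n * (a i * b (n ∸ i)))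
    ≡⟨ sumTo-cong n (λ i i≤n →
         trans (cong (λ k → + k * (a i * b (n ∸ i))) (sym (ℕ.m+[n∸m]≡n i≤n)))
               (split-weight (+ i) (+ (n ∸ i)) (a i) (b (n ∸ i)))) ⟩
  sumTo n (λ i → (+ i * a i) * b (n ∸ i) + a i * (+ (n ∸ i) * b (n ∸ i)))
    ≡⟨ sumTo-distrib-+ n _ _ ⟩
  (θ a ⊛ b) n + (a ⊛ θ b) n ∎
  where
  split-weight : ∀ x y u v → (x + y) * (u * v) ≡ (x * u) * v + u * (y * v)
  split-weight = solve-∀

θ-pow : ∀ (a : Series) k n → θ (pow a (suc k)) n ≡ + suc k * (θ a ⊛ pow a k) n
θ-pow a zero n = begin
  θ (a ⊛ one) n                    ≡⟨ θ-⊛ a one n ⟩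
  (θ a ⊛ one) n + (a ⊛ θ one) n    ≡⟨ cong (λ t → (θ a ⊛ one) n + t) (⊛-zeroʳ a (θ one) θ-one n) ⟩
  (θ a ⊛ one) n + 0ℤ               ≡⟨ ℤ.+-identityʳ _ ⟩
  (θ a ⊛ one) n                    ≡⟨ sym (ℤ.*-identityˡ _) ⟩
  + 1 * (θ a ⊛ one) n              ∎
θ-pow a (suc k) n = begin
  θ (a ⊛ pow a (suc k)) n
    ≡⟨ θ-⊛ a (pow a (suc k)) n ⟩
  X + (a ⊛ θ (pow a (suc k))) n
    ≡⟨ cong (λ t → X + t) (⊛-congʳ a _ (+ suc k · (θ a ⊛ pow a k)) (θ-pow a k) n) ⟩
  X + (a ⊛ (+ suc k · (θ a ⊛ pow a k))) n
    ≡⟨ cong (λ t → X + t) (⊛-·ʳ (+ suc k) a (θ a ⊛ pow a k) n) ⟩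
  X + + suc k * (a ⊛ (θ a ⊛ pow a k)) n
    ≡⟨ cong (λ t → X + + suc k * t) (begin
         (a ⊛ (θ a ⊛ pow a k)) n ≡⟨ sym (⊛-assoc a (θ a) (pow a k) n) ⟩
         ((a ⊛ θ a) ⊛ pow a k) n ≡⟨ ⊛-congˡ (a ⊛ θ a) (θ a ⊛ a) (pow a k) (⊛-comm a (θ a)) n ⟩
         ((θ a ⊛ a) ⊛ pow a k) n ≡⟨ ⊛-assoc (θ a) a (pow a k) n ⟩
         X                       ∎) ⟩
  X + + suc k * X
    ≡⟨ one-plus (+ suc k) X ⟩
  + suc (suc k) * X ∎
  where
  X : ℤ
  X = (θ a ⊛ pow a (suc k)) n
  one-plus : ∀ m x → x + m * x ≡ (1ℤ + m) * x
  one-plus = solve-∀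

infix 4 _∣θ_

record _∣θ_ (M : ℕ) (a : Series) : Set where
  constructor θ-divides
  field
    quotient : Series
    equality : ∀ n → θ a n ≡ + M * quotient n

∣θ-one : ∀ M → M ∣θ one
∣θ-one M = θ-divides (λ _ → 0ℤ) λ n → trans (θ-one n) (sym (ℤ.*-zeroʳ (+ M)))

∣θ-pow : ∀ a k → suc k ∣θ pow a (suc k)
∣θ-pow a k = θ-divides (θ a ⊛ pow a k) (θ-pow a k)

∣θ-⊛ : ∀ {M a b} → M ∣θ a → M ∣θ b → M ∣θ a ⊛ b
∣θ-⊛ {M} {a} {b} (θ-divides qa θa≡) (θ-divides qb θb≡) =
  θ-divides (λ n → (qa ⊛ b) n + (a ⊛ qb) n) λ n → begin
  θ (a ⊛ b) n
    ≡⟨ θ-⊛ a b n ⟩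
  (θ a ⊛ b) n + (a ⊛ θ b) n
    ≡⟨ cong₂ _+_ (trans (⊛-congˡ (θ a) (+ M · qa) b θa≡ n) (⊛-·ˡ (+ M) qa b n))
                 (trans (⊛-congʳ a (θ b) (+ M · qb) θb≡ n) (⊛-·ʳ (+ M) a qb n)) ⟩
  + M * (qa ⊛ b) n + + M * (a ⊛ qb) n
    ≡⟨ sym (ℤ.*-distribˡ-+ (+ M) _ _) ⟩
  + M * ((qa ⊛ b) n + (a ⊛ qb) n) ∎

∣θ-partialProd : ∀ k N → suc k ∣θ partialProd -[1+ k ] N
∣θ-partialProd k zero    = ∣θ-one (suc k)
∣θ-partialProd k (suc N) = ∣θ-⊛ (∣θ-pow (invOneMinusQ^ (suc N)) k) (∣θ-partialProd k N)

m∣n*darcais[-m,n] : ∀ M → 1 ≤ M → ∀ n → M ℕ.∣ n ℕ.* ∣ darcais (- (+ M)) n ∣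
m∣n*darcais[-m,n] (suc k) _ n = ℕ.divides ∣ q n ∣ (begin
  n ℕ.* ∣ f ∣          ≡⟨ sym (ℤ.abs-* (+ n) f) ⟩
  ∣ + n * f ∣          ≡⟨ cong ∣_∣ (θP≡ n) ⟩
  ∣ + suc k * q n ∣    ≡⟨ ℤ.abs-* (+ suc k) (q n) ⟩
  suc k ℕ.* ∣ q n ∣    ≡⟨ ℕ.*-comm (suc k) _ ⟩
  ∣ q n ∣ ℕ.* suc k    ∎)
  where
  open _∣θ_ (∣θ-partialProd k n) renaming (quotient to q; equality to θP≡)
  f : ℤ
  f = darcais -[1+ k ] n

prime^∣*-cancelˡ : ∀ {ℓ c} → Prime ℓ → ¬ ℓ ℕ.∣ c → ∀ e g → ℓ ^ e ℕ.∣ c ℕ.* g → ℓ ^ e ℕ.∣ g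
prime^∣*-cancelˡ             pℓ ℓ∤c zero    g _ = ℕ.1∣ g
prime^∣*-cancelˡ {ℓ} {c} pℓ ℓ∤c (suc e) g ℓ^1+e∣cg
  with euclidsLemma c g pℓ (ℕ.∣-trans (ℕ.m∣m*n (ℓ ^ e)) ℓ^1+e∣cg)
... | inj₁ ℓ∣c = contradiction ℓ∣c ℓ∤c
... | inj₂ (ℕ.divides-refl g′) =
  ℕ.∣-trans (ℕ.*-monoʳ-∣ ℓ (prime^∣*-cancelˡ pℓ ℓ∤c e g′ ℓ^e∣cg′))
            (ℕ.∣-reflexive (ℕ.*-comm ℓ g′))
  where
  instance _ = prime⇒nonZero pℓ
  ℓ^e∣cg′ : ℓ ^ e ℕ.∣ c ℕ.* g′
  ℓ^e∣cg′ = ℕ.*-cancelˡ-∣ ℓ (ℕ.∣-trans ℓ^1+e∣cg (ℕ.∣-reflexive (move-ℓ c g′ ℓ)))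
    where
    move-ℓ : ∀ x y z → x ℕ.* (y ℕ.* z) ≡ z ℕ.* (x ℕ.* y)
    move-ℓ = ℕ-Solver.solve-∀

ord-∣*-cancelˡ : ∀ {ℓ n j b} g → Prime ℓ → Ord ℓ n b → b ≤ j →
                 ℓ ^ j ℕ.∣ n ℕ.* g → ℓ ^ (j ∸ b) ℕ.∣ g
ord-∣*-cancelˡ {ℓ} {n} {j} {b} g pℓ ord b≤j ℓ^j∣ng with Ord.divides ord
... | ℕ.divides c n≡cℓ^b = prime^∣*-cancelˡ pℓ ℓ∤c (j ∸ b) g ℓ^[j∸b]∣cg
  where
  instance
    _ : NonZero (ℓ ^ b)
    _ = ℕ.m^n≢0 ℓ b {{prime⇒nonZero pℓ}}
  ℓ∤c : ¬ ℓ ℕ.∣ c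
  ℓ∤c (ℕ.divides d c≡dℓ) = Ord.notDivides ord (ℕ.divides d (begin
    n                  ≡⟨ n≡cℓ^b ⟩
    c ℕ.* ℓ ^ b        ≡⟨ cong (ℕ._* ℓ ^ b) c≡dℓ ⟩
    d ℕ.* ℓ ℕ.* ℓ ^ b  ≡⟨ ℕ.*-assoc d ℓ (ℓ ^ b) ⟩
    d ℕ.* ℓ ^ suc b    ∎))
  ℓ^j≡ : ℓ ^ b ℕ.* ℓ ^ (j ∸ b) ≡ ℓ ^ j
  ℓ^j≡ = trans (sym (ℕ.^-distribˡ-+-* ℓ b (j ∸ b))) (cong (ℓ ^_) (ℕ.m+[n∸m]≡n b≤j))
  ng≡ : n ℕ.* g ≡ ℓ ^ b ℕ.* (c ℕ.* g)
  ng≡ = begin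
    n ℕ.* g              ≡⟨ cong (ℕ._* g) n≡cℓ^b ⟩
    c ℕ.* ℓ ^ b ℕ.* g    ≡⟨ cong (ℕ._* g) (ℕ.*-comm c (ℓ ^ b)) ⟩
    ℓ ^ b ℕ.* c ℕ.* g    ≡⟨ ℕ.*-assoc (ℓ ^ b) c g ⟩
    ℓ ^ b ℕ.* (c ℕ.* g)  ∎
  ℓ^[j∸b]∣cg : ℓ ^ (j ∸ b) ℕ.∣ c ℕ.* g
  ℓ^[j∸b]∣cg = ℕ.*-cancelˡ-∣ (ℓ ^ b)
    (subst₂ ℕ._∣_ (sym ℓ^j≡) ng≡ ℓ^j∣ng)

corollary2p3 : (ℓ n j b : ℕ) → Prime ℓ → 1 ≤ n → 1 ≤ j → Ord ℓ n b → b < j →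
    (+ (ℓ ^ (j ∸ b))) ∣ darcais (- (+ (ℓ ^ j))) n
corollary2p3 ℓ n j b pℓ _ _ ord b<j =
  ord-∣*-cancelˡ _ pℓ ord (ℕ.<⇒≤ b<j)
    (m∣n*darcais[-m,n] (ℓ ^ j) (ℕ.m^n>0 ℓ {{prime⇒nonZero pℓ}} j) n)
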